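{- The family of quaternary relations $\langle R^{(d)}\mid d\in\omega\rangle$ is uniformly existential on $\mathbf M$, where for $a,b,c,t\in\mathbf M_d$, $R^{(d)}(a,b,c,t)$ holds iff $t\le d$ and $a\oslash_{d,t}b=c$.
   Context: $\mathcal M$ is the first-order language with equality with constants $\mathbf 0,\mathbf 1,-\mathbf 1,\mathbf n$, unary $\mathcal N,\mathbf p$, binary $+,\times,\div,\max,\min,\cap$; $\mathbf M_d$ ($n=2^d$) has universe $\{0,\dots,2^n-1\}$ with $+,\times$ mod $2^n$, $\mathbf p(x)=\min\{2^x,2^n-1\}$, $\div(x,y)=\lfloor x/y\rfloor$ ($0$ for $y=0$), constants $0,1,n,2^n-1$, usual $\max,\min$, bitwise AND $\cap$ and bitwise complement $\mathcal N$. $a[i,t]$ is the $i$-th digit of $a$ in base $2^{2^t}$. For $t\le d$ and $a,b\in\mathbf M_d$: if $b=0$ then $a\oslash_{d,t}b=0$; if $b\ne0$ then $a\oslash_{d,t}b$ is the unique $c\in\mathbf M_d$ with $c[k,t]=\lfloor a[k,t]/b\rfloor$ for all $k<2^{d-t}$. A family $\langle R^{(d)}\rangle$ of relations, $R^{(d)}$ on $\mathbf M_d$, is uniformly existential on $\mathbf M$ if a single existential formula $\phi$ of $\mathcal M$ satisfies: for all $d$ and all tuples $\bar a$ from $\mathbf M_d$, $R^{(d)}(\bar a)$ iff $\mathbf M_d\models\phi(\bar a)$. -}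

module Defs where

open import Data.Nat using (ℕ; zero; suc; _+_; _*_; _∸_; _^_; _≤_; _<_; _⊔_; _⊓_)
open import Data.Nat.DivMod using (_/_; _%_)
open import Data.Fin using (Fin)
open import Data.Vec.Functional using (Vector; _++_)
open import Data.Product using (Σ; _×_)
open import Data.Sum using (_⊎_)
open import Data.Empty using (⊥)
open import Relation.Binary.PropositionalEquality using (_≡_)
open import Relation.Nullary using (¬_)

-- The structures M_d.  n = 2^d, universe {0, …, 2^n − 1}.

nOf : ℕ → ℕ
nOf d = 2 ^ d

size : ℕ → ℕ
size d = 2 ^ nOf d

divN : ℕ → ℕ → ℕ
divN x zero    = 0
divN x (suc y) = x / suc y

-- x mod y (size d is always nonzero, so the zero case is never used)
modN : ℕ → ℕ → ℕ
modN x zero    = x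
modN x (suc y) = x % suc y

bitAnd : ℕ → ℕ → ℕ → ℕ
bitAnd zero    x y = 0
bitAnd (suc f) x y = ((x % 2) * (y % 2)) + 2 * bitAnd f (x / 2) (y / 2)

bitNot : ℕ → ℕ → ℕ
bitNot zero    x = 0
bitNot (suc f) x = (1 ∸ (x % 2)) + 2 * bitNot f (x / 2)

addM : ℕ → ℕ → ℕ → ℕ
addM d x y = modN (x + y) (size d)

mulM : ℕ → ℕ → ℕ → ℕ
mulM d x y = modN (x * y) (size d)

pM : ℕ → ℕ → ℕ
pM d x = (2 ^ x) ⊓ (size d ∸ 1)

andM : ℕ → ℕ → ℕ → ℕ
andM d x y = bitAnd (nOf d) x y

notM : ℕ → ℕ → ℕ
notM d x = bitNot (nOf d) x

data Term (v : ℕ) : Set where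
  var   : Fin v → Term v
  c0    : Term v
  c1    : Term v
  cm1   : Term v
  cn    : Term v
  notT  : Term v → Term v
  pT    : Term v → Term v
  _+T_  : Term v → Term v → Term v
  _×T_  : Term v → Term v → Term v
  _÷T_  : Term v → Term v → Term v
  maxT  : Term v → Term v → Term v
  minT  : Term v → Term v → Term v
  _∩T_  : Term v → Term v → Term v

data QF (v : ℕ) : Set where
  _≐_  : Term v → Term v → QF v
  ¬F   : QF v → QF v
  _∧F_ : QF v → QF v → QF v
  _∨F_ : QF v → QF v → QF v

record ExFormula (v : ℕ) : Set where
  constructor ∃F
  field
    nbound : ℕ
    matrix : QF (v + nbound)

evalT : ∀ {v} → ℕ → Vector ℕ v → Term v → ℕ
evalT d ρ (var i)   = ρ i
evalT d ρ c0        = 0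
evalT d ρ c1        = 1
evalT d ρ cm1       = size d ∸ 1
evalT d ρ cn        = nOf d
evalT d ρ (notT s)  = notM d (evalT d ρ s)
evalT d ρ (pT s)    = pM d (evalT d ρ s)
evalT d ρ (s +T u)  = addM d (evalT d ρ s) (evalT d ρ u)
evalT d ρ (s ×T u)  = mulM d (evalT d ρ s) (evalT d ρ u)
evalT d ρ (s ÷T u)  = divN (evalT d ρ s) (evalT d ρ u)
evalT d ρ (maxT s u) = evalT d ρ s ⊔ evalT d ρ u
evalT d ρ (minT s u) = evalT d ρ s ⊓ evalT d ρ u
evalT d ρ (s ∩T u)  = andM d (evalT d ρ s) (evalT d ρ u)

SatQF : ∀ {v} → ℕ → Vector ℕ v → QF v → Set
SatQF d ρ (s ≐ u)   = evalT d ρ s ≡ evalT d ρ u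
SatQF d ρ (¬F φ)    = ¬ SatQF d ρ φ
SatQF d ρ (φ ∧F ψ)  = SatQF d ρ φ × SatQF d ρ ψ
SatQF d ρ (φ ∨F ψ)  = SatQF d ρ φ ⊎ SatQF d ρ ψ

Sat : ∀ {v} → ℕ → Vector ℕ v → ExFormula v → Set
Sat d ρ (∃F k φ) =
  Σ (Vector ℕ k) λ w → ((i : Fin k) → w i < size d) × SatQF d (ρ ++ w) φ

digit : ℕ → ℕ → ℕ → ℕ
digit a i t = modN (divN a (B ^ i)) B
  where B = 2 ^ (2 ^ t)

OslashIs : ℕ → ℕ → ℕ → ℕ → ℕ → Set
OslashIs d t a b c =
    (b ≡ 0 × c ≡ 0)
  ⊎ (¬ (b ≡ 0) × ((k : ℕ) → k < 2 ^ (d ∸ t) → digit c k t ≡ divN (digit a k t) b))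

R : ℕ → ℕ → ℕ → ℕ → ℕ → Set
R d a b c t = t ≤ d × OslashIs d t a b c

module Submission where

-- The digits of a in base B = 2^(2^t) are divided by b all at once, using the
-- operations of M_d as parallel machine arithmetic.  If b = 0 then c = 0; if t = d
-- then a is a single digit and c = a ÷ b; if B ≤ b every quotient is 0.  Otherwise
-- the universe is cut into blocks of S = B² (two digits each); the even digits of
-- a, and separately those of a ÷ B, sit in the low halves of these blocks, with the
-- high halves serving as carry space.  The quotients are then certified by a
-- remainder vector r: masking by Σ_j (B − 1) S^j extracts the low halves,
-- b · c + r = a must hold blockwise, and r_j < b holds iff adding B − b to r_j
-- does not carry into the high half.  Every constant involved is a term:
-- B = p(p(t)) and Σ_j S^j = (2^n − 1) ÷ (S − 1).

open import Defs
open import Data.Nat using (ℕ; _<_)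
open import Data.Vec using (_∷_; []; lookup)
open import Data.Product using (Σ)
open import Function.Bundles using (_⇔_)

open import Data.Nat
open import Data.Nat.Properties
open import Data.Nat.DivMod
open import Data.Nat.Divisibility using (m∣m*n)
open import Data.Nat.Tactic.RingSolver using (solve-∀)
open import Data.Fin using (zero; suc; #_)
open import Data.Vec.Functional using (Vector; _++_)
open import Data.Product using (_×_; _,_; proj₁; proj₂)
open import Data.Sum using (inj₁; inj₂)
open import Data.Empty using (⊥-elim)
open import Relation.Nullary using (¬_; yes; no)
open import Relation.Binary.PropositionalEquality
open import Function.Bundles using (mk⇔; Equivalence)
open import Function.Base using (id; _∘_)

m≡m%n+n*[m/n] : ∀ m n .{{_ : NonZero n}} → m ≡ m % n + n * (m / n)
m≡m%n+n*[m/n] m n = trans (m≡m%n+[m/n]*n m n) (cong (m % n +_) (*-comm (m / n) n))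

[m+n*k]%n≡m%n : ∀ m k n .{{_ : NonZero n}} → (m + n * k) % n ≡ m % n
[m+n*k]%n≡m%n m k n = trans (cong (λ z → (m + z) % n) (*-comm n k)) ([m+kn]%n≡m%n m k n)

[m+n*k]/n≡m/n+k : ∀ m k n .{{_ : NonZero n}} → (m + n * k) / n ≡ m / n + k
[m+n*k]/n≡m/n+k m k n = begin
  (m + n * k) / n    ≡⟨ +-distrib-/-∣ʳ m (m∣m*n k) ⟩
  m / n + n * k / n  ≡⟨ cong (λ z → m / n + z / n) (*-comm n k) ⟩
  m / n + k * n / n  ≡⟨ cong (m / n +_) (m*n/n≡m k n) ⟩
  m / n + k          ∎
  where open ≡-Reasoning

[r+n*q]%n≡r : ∀ {r} q n .{{_ : NonZero n}} → r < n → (r + n * q) % n ≡ r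
[r+n*q]%n≡r {r} q n r<n = trans ([m+n*k]%n≡m%n r q n) (m<n⇒m%n≡m r<n)

[r+n*q]/n≡q : ∀ {r} q n .{{_ : NonZero n}} → r < n → (r + n * q) / n ≡ q
[r+n*q]/n≡q {r} q n r<n = trans ([m+n*k]/n≡m/n+k r q n) (cong (_+ q) (m<n⇒m/n≡0 r<n))

divMod-unique : ∀ {r₁ q₁ r₂ q₂} n .{{_ : NonZero n}} → r₁ < n → r₂ < n →
                r₁ + n * q₁ ≡ r₂ + n * q₂ → r₁ ≡ r₂ × q₁ ≡ q₂
divMod-unique {r₁} {q₁} {r₂} {q₂} n r₁<n r₂<n eq =
  trans (sym ([r+n*q]%n≡r q₁ n r₁<n)) (trans (cong (_% n) eq) ([r+n*q]%n≡r q₂ n r₂<n)) ,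
  trans (sym ([r+n*q]/n≡q q₁ n r₁<n)) (trans (cong (_/ n) eq) ([r+n*q]/n≡q q₂ n r₂<n))

modN≡% : ∀ x m .{{_ : NonZero m}} → modN x m ≡ x % m
modN≡% x (suc m) = refl

divN≡/ : ∀ x m .{{_ : NonZero m}} → divN x m ≡ x / m
divN≡/ x (suc m) = refl

[x%m+y*[m∸1]%m]%m≡x∸y : ∀ m {x y} .{{_ : NonZero m}} → 0 < y → y ≤ x → x ≤ m →
                        (x % m + y * (m ∸ 1) % m) % m ≡ x ∸ y
[x%m+y*[m∸1]%m]%m≡x∸y m@(suc k) {x} {y} 0<y y≤x x≤m = begin
  (x % m + y * k % m) % m  ≡⟨ %-distribˡ-+ x (y * k) m ⟨
  (x + y * k) % m          ≡⟨ cong (λ z → (z + y * k) % m) (m+[n∸m]≡n y≤x) ⟨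
  (y + (x ∸ y) + y * k) % m ≡⟨ cong (_% m) (regroup y (x ∸ y) k) ⟩
  (x ∸ y + y * m) % m      ≡⟨ [m+kn]%n≡m%n (x ∸ y) y m ⟩
  (x ∸ y) % m              ≡⟨ m<n⇒m%n≡m (<-≤-trans (∸-monoʳ-< 0<y y≤x) x≤m) ⟩
  x ∸ y                    ∎
  where
  open ≡-Reasoning
  regroup : ∀ y u k → y + u + y * k ≡ u + y * suc k
  regroup = solve-∀

m%[2*n]≡m%2+2*[m/2%n] : ∀ m n .{{_ : NonZero n}} .{{_ : NonZero (2 * n)}} →
                        m % (2 * n) ≡ m % 2 + 2 * (m / 2 % n)
m%[2*n]≡m%2+2*[m/2%n] m n = trans (cong (_% (2 * n)) m≡) ([r+n*q]%n≡r (m / 2 / n) (2 * n) r<2n)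
  where
  regroup : ∀ a b c n → a + 2 * (b + n * c) ≡ a + 2 * b + 2 * n * c
  regroup = solve-∀
  m≡ : m ≡ m % 2 + 2 * (m / 2 % n) + 2 * n * (m / 2 / n)
  m≡ = begin
    m                                          ≡⟨ m≡m%n+n*[m/n] m 2 ⟩
    m % 2 + 2 * (m / 2)                        ≡⟨ cong (λ z → m % 2 + 2 * z) (m≡m%n+n*[m/n] (m / 2) n) ⟩
    m % 2 + 2 * (m / 2 % n + n * (m / 2 / n))  ≡⟨ regroup (m % 2) (m / 2 % n) (m / 2 / n) n ⟩
    m % 2 + 2 * (m / 2 % n) + 2 * n * (m / 2 / n) ∎
    where open ≡-Reasoning
  r<2n : m % 2 + 2 * (m / 2 % n) < 2 * n
  r<2n = begin-strict
    m % 2 + 2 * (m / 2 % n)  <⟨ +-monoˡ-< _ (m%n<n m 2) ⟩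
    2 + 2 * (m / 2 % n)      ≡⟨ *-suc 2 _ ⟨
    2 * suc (m / 2 % n)      ≤⟨ *-monoʳ-≤ 2 (m%n<n (m / 2) n) ⟩
    2 * n                    ∎
    where open ≤-Reasoning

2^n≢0 : ∀ n → NonZero (2 ^ n)
2^n≢0 n = m^n≢0 2 n

n<2^n : ∀ n → n < 2 ^ n
n<2^n zero    = s≤s z≤n
n<2^n (suc n) = begin-strict
  suc n          ≤⟨ n<2^n n ⟩
  2 ^ n          <⟨ m<m+n (2 ^ n) (m^n>0 2 n) ⟩
  2 ^ n + 2 ^ n  ≡⟨ cong (2 ^ n +_) (+-identityʳ (2 ^ n)) ⟨
  2 ^ suc n      ∎
  where open ≤-Reasoning

2^-cancel-≤ : ∀ {m n} → 2 ^ m ≤ 2 ^ n → m ≤ n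
2^-cancel-≤ {m} {n} le with m ≤? n
... | yes m≤n = m≤n
... | no  m≰n = ⊥-elim (<⇒≱ (^-monoʳ-< 2 (s≤s (s≤s z≤n)) (≰⇒> m≰n)) le)

2^-injective : ∀ {m n} → 2 ^ m ≡ 2 ^ n → m ≡ n
2^-injective eq = ≤-antisym (2^-cancel-≤ (≤-reflexive eq)) (2^-cancel-≤ (≤-reflexive (sym eq)))

2^[1+n]∸1≡1+2*[2^n∸1] : ∀ n → 2 ^ suc n ∸ 1 ≡ 1 + 2 * (2 ^ n ∸ 1)
2^[1+n]∸1≡1+2*[2^n∸1] n with 2 ^ n | m^n>0 2 n
... | suc k | _ = +-suc k (k + 0)

infixl 7 _/2^_

_/2^_ : ℕ → ℕ → ℕ
x /2^ m = _/_ x (2 ^ m) {{2^n≢0 m}}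

bitAnd-zeroʳ : ∀ m x → bitAnd m x 0 ≡ 0
bitAnd-zeroʳ zero    x = refl
bitAnd-zeroʳ (suc m) x rewrite bitAnd-zeroʳ m (x / 2) | *-zeroʳ (x % 2) = refl

bitAnd-+2^* : ∀ m x y z → bitAnd m x (y + 2 ^ m * z) ≡ bitAnd m x y
bitAnd-+2^* zero    x y z = refl
bitAnd-+2^* (suc m) x y z = cong₂ (λ u v → x % 2 * u + 2 * v) low rest
  where
  y+ : y + 2 ^ suc m * z ≡ y + 2 * (2 ^ m * z)
  y+ = cong (y +_) (*-assoc 2 (2 ^ m) z)
  low : (y + 2 ^ suc m * z) % 2 ≡ y % 2
  low = trans (cong (_% 2) y+) ([m+n*k]%n≡m%n y (2 ^ m * z) 2)
  rest : bitAnd m (x / 2) ((y + 2 ^ suc m * z) / 2) ≡ bitAnd m (x / 2) (y / 2)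
  rest = begin
    bitAnd m (x / 2) ((y + 2 ^ suc m * z) / 2)   ≡⟨ cong (λ u → bitAnd m (x / 2) (u / 2)) y+ ⟩
    bitAnd m (x / 2) ((y + 2 * (2 ^ m * z)) / 2) ≡⟨ cong (bitAnd m (x / 2)) ([m+n*k]/n≡m/n+k y (2 ^ m * z) 2) ⟩
    bitAnd m (x / 2) (y / 2 + 2 ^ m * z)         ≡⟨ bitAnd-+2^* m (x / 2) (y / 2) z ⟩
    bitAnd m (x / 2) (y / 2)                     ∎
    where open ≡-Reasoning

bitAnd-+ : ∀ m f x y → bitAnd (m + f) x y ≡ bitAnd m x y + 2 ^ m * bitAnd f (x /2^ m) (y /2^ m)
bitAnd-+ zero f x y = sym (trans (+-identityʳ _) (cong₂ (bitAnd f) (n/1≡n x) (n/1≡n y)))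
bitAnd-+ (suc m) f x y = begin
  x % 2 * (y % 2) + 2 * bitAnd (m + f) (x / 2) (y / 2)
    ≡⟨ cong (λ v → x % 2 * (y % 2) + 2 * v) (bitAnd-+ m f (x / 2) (y / 2)) ⟩
  x % 2 * (y % 2) + 2 * (bitAnd m (x / 2) (y / 2) + 2 ^ m * bitAnd f (x / 2 /2^ m) (y / 2 /2^ m))
    ≡⟨ cong₂ (λ u v → x % 2 * (y % 2) + 2 * (bitAnd m (x / 2) (y / 2) + 2 ^ m * bitAnd f u v))
             (/2/2^ x) (/2/2^ y) ⟩
  x % 2 * (y % 2) + 2 * (bitAnd m (x / 2) (y / 2) + 2 ^ m * bitAnd f (x /2^ suc m) (y /2^ suc m))
    ≡⟨ regroup (x % 2 * (y % 2)) (bitAnd m (x / 2) (y / 2)) (2 ^ m) _ ⟩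
  x % 2 * (y % 2) + 2 * bitAnd m (x / 2) (y / 2) + 2 ^ suc m * bitAnd f (x /2^ suc m) (y /2^ suc m) ∎
  where
  open ≡-Reasoning
  /2/2^ : ∀ x → x / 2 /2^ m ≡ x /2^ suc m
  /2/2^ x = m/n/o≡m/[n*o] x 2 (2 ^ m) {{_}} {{2^n≢0 m}} {{2^n≢0 (suc m)}}
  regroup : ∀ a b c d → a + 2 * (b + c * d) ≡ a + 2 * b + 2 * c * d
  regroup = solve-∀

bitAnd-2^∸1 : ∀ m x .{{_ : NonZero (2 ^ m)}} → bitAnd m x (2 ^ m ∸ 1) ≡ x % 2 ^ m
bitAnd-2^∸1 zero    x = sym (n%1≡0 x)
bitAnd-2^∸1 (suc m) x = begin
  x % 2 * (mask % 2) + 2 * bitAnd m (x / 2) (mask / 2)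
    ≡⟨ cong₂ (λ u v → x % 2 * u + 2 * bitAnd m (x / 2) v) mask%2 mask/2 ⟩
  x % 2 * 1 + 2 * bitAnd m (x / 2) (2 ^ m ∸ 1)
    ≡⟨ cong₂ (λ u v → u + 2 * v) (*-identityʳ (x % 2)) (bitAnd-2^∸1 m (x / 2) {{2^n≢0 m}}) ⟩
  x % 2 + 2 * (_%_ (x / 2) (2 ^ m) {{2^n≢0 m}})
    ≡⟨ m%[2*n]≡m%2+2*[m/2%n] x (2 ^ m) {{2^n≢0 m}} ⟨
  x % 2 ^ suc m ∎
  where
  open ≡-Reasoning
  mask = 2 ^ suc m ∸ 1
  mask%2 : mask % 2 ≡ 1
  mask%2 = trans (cong (_% 2) (2^[1+n]∸1≡1+2*[2^n∸1] m)) ([r+n*q]%n≡r (2 ^ m ∸ 1) 2 (s≤s (s≤s z≤n)))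
  mask/2 : mask / 2 ≡ 2 ^ m ∸ 1
  mask/2 = trans (cong (_/ 2) (2^[1+n]∸1≡1+2*[2^n∸1] m)) ([r+n*q]/n≡q (2 ^ m ∸ 1) 2 (s≤s (s≤s z≤n)))

bitAnd-comm : ∀ m x y → bitAnd m x y ≡ bitAnd m y x
bitAnd-comm zero    x y = refl
bitAnd-comm (suc m) x y = cong₂ (λ u v → u + 2 * v) (*-comm (x % 2) (y % 2)) (bitAnd-comm m (x / 2) (y / 2))

-- Numbers as strings of blocks of 2w bits

module Blocks (w : ℕ) where

  B : ℕ
  B = 2 ^ w

  S : ℕ
  S = B * B

  W : ℕ
  W = w + w

  instance
    B-nonZero : NonZero B
    B-nonZero = 2^n≢0 w
    S-nonZero : NonZero S
    S-nonZero = m*n≢0 B B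

  2^W≡S : 2 ^ W ≡ S
  2^W≡S = ^-distribˡ-+-* 2 w w

  /2^W≡/S : ∀ y → y /2^ W ≡ y / S
  /2^W≡/S y = /-congʳ {{2^n≢0 W}} 2^W≡S

  B≤S : B ≤ S
  B≤S = m≤m*n B B

  B∸1<B : B ∸ 1 < B
  B∸1<B = ∸-monoʳ-< {o = 0} (s≤s z≤n) (m^n>0 2 w)

  %S%B≡%B : ∀ y → y % S % B ≡ y % B
  %S%B≡%B y = m∣n⇒o%n%m≡o%m B S y (m∣m*n B)

  infixl 7 _/S^_

  _/S^_ : ℕ → ℕ → ℕ
  y /S^ j = _/_ y (S ^ j) {{m^n≢0 S j}}

  /S^suc : ∀ y j → y /S^ suc j ≡ y / S /S^ j
  /S^suc y j = sym (m/n/o≡m/[n*o] y S (S ^ j) {{_}} {{m^n≢0 S j}} {{m^n≢0 S (suc j)}})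

  lowHalf : ℕ → ℕ → ℕ
  lowHalf y j = y /S^ j % B

  lowHalf-zero : ∀ y → lowHalf y 0 ≡ y % S % B
  lowHalf-zero y = trans (cong (_% B) (n/1≡n y)) (sym (%S%B≡%B y))

  lowHalf-suc : ∀ y j → lowHalf y (suc j) ≡ lowHalf (y / S) j
  lowHalf-suc y j = cong (_% B) (/S^suc y j)

  repunit : ℕ → ℕ
  repunit zero    = 0
  repunit (suc s) = 1 + S * repunit s

  repunit-suc : ∀ m s → m * repunit (suc s) ≡ m + S * (m * repunit s)
  repunit-suc m s = regroup m S (repunit s)
    where
    regroup : ∀ k S f → k * (1 + S * f) ≡ k + S * (k * f)
    regroup = solve-∀

  blockwise : (ℕ → ℕ) → ℕ → ℕ → ℕ
  blockwise g zero    y = 0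
  blockwise g (suc s) y = g (y % S) + S * blockwise g s (y / S)

  blockwise-+ : ∀ g s {x} y → x < S → blockwise g (suc s) (x + S * y) ≡ g x + S * blockwise g s y
  blockwise-+ g s y x<S = cong₂ (λ u v → g u + S * blockwise g s v) ([r+n*q]%n≡r y S x<S) ([r+n*q]/n≡q y S x<S)

  blockwise-cong : ∀ {f g} → (∀ v → v < S → f v ≡ g v) → ∀ s y → blockwise f s y ≡ blockwise g s y
  blockwise-cong f≗g zero    y = refl
  blockwise-cong f≗g (suc s) y =
    cong₂ (λ u v → u + S * v) (f≗g (y % S) (m%n<n y S)) (blockwise-cong f≗g s (y / S))

  blockwise-≤ : ∀ {g K} → (∀ v → v < S → g v ≤ K) → ∀ s y → blockwise g s y ≤ K * repunit s
  blockwise-≤ {g} {K} g≤K zero    y = z≤n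
  blockwise-≤ {g} {K} g≤K (suc s) y = begin
    g (y % S) + S * blockwise g s (y / S)
      ≤⟨ +-mono-≤ (g≤K (y % S) (m%n<n y S)) (*-monoʳ-≤ S (blockwise-≤ g≤K s (y / S))) ⟩
    K + S * (K * repunit s)
      ≡⟨ repunit-suc K s ⟨
    K * repunit (suc s) ∎
    where open ≤-Reasoning

  bitAnd-periodic : ∀ m → m < S → ∀ s y →
                    bitAnd (s * W) y (m * repunit s) ≡ blockwise (λ v → bitAnd W v m) s y
  bitAnd-periodic m m<S zero    y = bitAnd-zeroʳ 0 y
  bitAnd-periodic m m<S (suc s) y = begin
    bitAnd (W + s * W) y (m * repunit (suc s))
      ≡⟨ cong (bitAnd (W + s * W) y) (repunit-suc m s) ⟩
    bitAnd (W + s * W) y (m + S * (m * repunit s))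
      ≡⟨ bitAnd-+ W (s * W) y _ ⟩
    bitAnd W y (m + S * (m * repunit s)) + 2 ^ W * bitAnd (s * W) (y /2^ W) ((m + S * (m * repunit s)) /2^ W)
      ≡⟨ cong₂ _+_ firstBlock (cong₂ _*_ 2^W≡S rest) ⟩
    bitAnd W (y % S) m + S * blockwise (λ v → bitAnd W v m) s (y / S) ∎
    where
    open ≡-Reasoning
    bitAnd-W-%S : ∀ x v → bitAnd W x v ≡ bitAnd W x (v % S)
    bitAnd-W-%S x v = begin
      bitAnd W x v                            ≡⟨ cong (bitAnd W x) (m≡m%n+n*[m/n] v S) ⟩
      bitAnd W x (v % S + S * (v / S))        ≡⟨ cong (λ z → bitAnd W x (v % S + z * (v / S))) 2^W≡S ⟨
      bitAnd W x (v % S + 2 ^ W * (v / S))    ≡⟨ bitAnd-+2^* W x (v % S) (v / S) ⟩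
      bitAnd W x (v % S)                      ∎
    firstBlock : bitAnd W y (m + S * (m * repunit s)) ≡ bitAnd W (y % S) m
    firstBlock = begin
      bitAnd W y (m + S * (m * repunit s))  ≡⟨ bitAnd-W-%S y _ ⟩
      bitAnd W y (_ % S)                 ≡⟨ cong (bitAnd W y) ([r+n*q]%n≡r _ S m<S) ⟩
      bitAnd W y m                       ≡⟨ bitAnd-comm W y m ⟩
      bitAnd W m y                       ≡⟨ bitAnd-W-%S m y ⟩
      bitAnd W m (y % S)                 ≡⟨ bitAnd-comm W m (y % S) ⟩
      bitAnd W (y % S) m                 ∎
    rest : bitAnd (s * W) (y /2^ W) ((m + S * (m * repunit s)) /2^ W) ≡ blockwise (λ v → bitAnd W v m) s (y / S)
    rest = begin
      bitAnd (s * W) (y /2^ W) ((m + S * (m * repunit s)) /2^ W)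
        ≡⟨ cong₂ (bitAnd (s * W)) (/2^W≡/S y) (trans (/2^W≡/S _) ([r+n*q]/n≡q _ S m<S)) ⟩
      bitAnd (s * W) (y / S) (m * repunit s)
        ≡⟨ bitAnd-periodic m m<S s (y / S) ⟩
      blockwise (λ v → bitAnd W v m) s (y / S) ∎

  bitAnd-lowBlock : ∀ v → bitAnd W v (B ∸ 1) ≡ v % B
  bitAnd-lowBlock v = begin
    bitAnd W v (B ∸ 1)
      ≡⟨ bitAnd-+ w w v (B ∸ 1) ⟩
    bitAnd w v (B ∸ 1) + B * bitAnd w (v / B) ((B ∸ 1) / B)
      ≡⟨ cong (λ z → bitAnd w v (B ∸ 1) + B * bitAnd w (v / B) z) (m<n⇒m/n≡0 B∸1<B) ⟩
    bitAnd w v (B ∸ 1) + B * bitAnd w (v / B) 0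
      ≡⟨ cong (λ z → bitAnd w v (B ∸ 1) + B * z) (bitAnd-zeroʳ w (v / B)) ⟩
    bitAnd w v (B ∸ 1) + B * 0
      ≡⟨ trans (cong (bitAnd w v (B ∸ 1) +_) (*-zeroʳ B)) (+-identityʳ _) ⟩
    bitAnd w v (B ∸ 1)
      ≡⟨ bitAnd-2^∸1 w v ⟩
    v % B ∎
    where open ≡-Reasoning

  bitAnd-highBlock : ∀ v → v < S → bitAnd W v (B * (B ∸ 1)) ≡ B * (v / B)
  bitAnd-highBlock v v<S = begin
    bitAnd W v (B * (B ∸ 1))
      ≡⟨ bitAnd-+ w w v _ ⟩
    bitAnd w v (B * (B ∸ 1)) + B * bitAnd w (v / B) (B * (B ∸ 1) / B)
      ≡⟨ cong₂ (λ u z → u + B * bitAnd w (v / B) z) noLow B*[B∸1]/B ⟩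
    0 + B * bitAnd w (v / B) (B ∸ 1)
      ≡⟨ cong (B *_) (bitAnd-2^∸1 w (v / B)) ⟩
    B * (v / B % B)
      ≡⟨ cong (B *_) (m<n⇒m%n≡m (m<n*o⇒m/o<n v<S)) ⟩
    B * (v / B) ∎
    where
    open ≡-Reasoning
    noLow : bitAnd w v (B * (B ∸ 1)) ≡ 0
    noLow = trans (bitAnd-+2^* w v 0 (B ∸ 1)) (bitAnd-zeroʳ w v)
    B*[B∸1]/B : B * (B ∸ 1) / B ≡ B ∸ 1
    B*[B∸1]/B = trans (cong (_/ B) (*-comm B (B ∸ 1))) (m*n/n≡m (B ∸ 1) B)

  low : ℕ → ℕ → ℕ
  low = blockwise (_% B)

  high : ℕ → ℕ → ℕ
  high = blockwise (λ v → B * (v / B))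

  lowBound : ∀ s y → low s y ≤ (B ∸ 1) * repunit s
  lowBound = blockwise-≤ (λ v _ → <⇒≤pred (m%n<n v B))

  low-fixed⇒≤ : ∀ s y → low s y ≡ y → y ≤ (B ∸ 1) * repunit s
  low-fixed⇒≤ s y fixed = subst (_≤ (B ∸ 1) * repunit s) fixed (lowBound s y)

  lowMask : ℕ → ℕ
  lowMask s = (B ∸ 1) * repunit s

  highMask : ℕ → ℕ
  highMask s = B * lowMask s

  bitAnd-lowMask : ∀ s y → bitAnd (s * W) y (lowMask s) ≡ low s y
  bitAnd-lowMask s y = trans (bitAnd-periodic (B ∸ 1) (<-≤-trans B∸1<B B≤S) s y)
                             (blockwise-cong (λ v _ → bitAnd-lowBlock v) s y)

  bitAnd-highMask : ∀ s y → bitAnd (s * W) y (highMask s) ≡ high s y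
  bitAnd-highMask s y = begin
    bitAnd (s * W) y (B * ((B ∸ 1) * repunit s))   ≡⟨ cong (bitAnd (s * W) y) (*-assoc B (B ∸ 1) (repunit s)) ⟨
    bitAnd (s * W) y (B * (B ∸ 1) * repunit s)     ≡⟨ bitAnd-periodic (B * (B ∸ 1)) (*-monoʳ-< B B∸1<B) s y ⟩
    blockwise (λ v → bitAnd W v (B * (B ∸ 1))) s y ≡⟨ blockwise-cong bitAnd-highBlock s y ⟩
    high s y                                    ∎
    where open ≡-Reasoning

  repunit-bound : ∀ s → (S ∸ 1) * repunit s + 1 ≡ S ^ s
  repunit-bound zero    = cong (_+ 1) (*-zeroʳ (S ∸ 1))
  repunit-bound (suc s) = subst (λ X → (S ∸ 1) * (1 + X * repunit s) + 1 ≡ X * S ^ s) (m+[n∸m]≡n 0<S)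
                             (step (S ∸ 1) (repunit s) (repunit-bound s))
    where
    0<S : 1 ≤ S
    0<S = >-nonZero⁻¹ S
    identity : ∀ k f → k * (1 + suc k * f) + 1 ≡ suc k * (k * f + 1)
    identity = solve-∀
    step : ∀ k f {P} → k * f + 1 ≡ P → k * (1 + suc k * f) + 1 ≡ suc k * P
    step k f refl = identity k f

  ≤*repunit⇒<S^ : ∀ s {X K} → K ≤ S ∸ 1 → X ≤ K * repunit s → X < S ^ s
  ≤*repunit⇒<S^ s {X} {K} K≤ X≤ = begin-strict
    X                  ≤⟨ X≤ ⟩
    K * repunit s         ≤⟨ *-monoˡ-≤ (repunit s) K≤ ⟩
    (S ∸ 1) * repunit s   <⟨ m<m+n _ (s≤s z≤n) ⟩
    (S ∸ 1) * repunit s + 1 ≡⟨ repunit-bound s ⟩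
    S ^ s              ∎
    where open ≤-Reasoning

  module BlockDivision (b : ℕ) .{{_ : NonZero b}} (b<B : b < B) where

    U : ℕ
    U = B ∸ b

    B≡b+U : B ≡ b + U
    B≡b+U = sym (m+[n∸m]≡n (<⇒≤ b<B))

    remainders : ℕ → ℕ → ℕ
    remainders = blockwise (λ v → v % B % b)

    -- ρ holds one remainder per block: its high halves are empty, b · yc + ρ = ya
    -- holds blockwise without carries, and no carry reaches a high half when B − b
    -- is added to every block, i.e. every remainder is below b.
    BlockDivision : ℕ → ℕ → ℕ → ℕ → Set
    BlockDivision s ya yc ρ = low s ρ ≡ ρ × b * low s yc + ρ ≡ low s ya × high s (ρ + U * repunit s) ≡ 0

    r+U<S : ∀ {r} → r < B → r + U < S
    r+U<S {r} r<B = begin-strict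
      r + U    <⟨ +-monoˡ-< U r<B ⟩
      B + U    ≤⟨ +-monoʳ-≤ B (m∸n≤m B b) ⟩
      B + B    ≡⟨ cong (B +_) (+-identityʳ B) ⟨
      2 * B    ≤⟨ *-monoˡ-≤ B (<-≤-trans (s≤s (>-nonZero⁻¹ b)) b<B) ⟩
      B * B    ∎
      where open ≤-Reasoning

    b*x+r<S : ∀ {x r} → x < B → r < b → b * x + r < S
    b*x+r<S {x} {r} x<B r<b = begin-strict
      b * x + r  <⟨ +-monoʳ-< (b * x) r<b ⟩
      b * x + b  ≡⟨ trans (*-suc b x) (+-comm b (b * x)) ⟨
      b * suc x  ≤⟨ *-mono-≤ (<⇒≤ b<B) x<B ⟩
      B * B      ∎
      where open ≤-Reasoning

    regroup-sum : ∀ x m r r' → b * (x + S * m) + (r + S * r') ≡ (b * x + r) + S * (b * m + r')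
    regroup-sum x m r r' = identity b x m r r' S
      where
      identity : ∀ b x m r r' S → b * (x + S * m) + (r + S * r') ≡ (b * x + r) + S * (b * m + r')
      identity = solve-∀

    regroup-carry : ∀ s r r' → (r + S * r') + U * repunit (suc s) ≡ (r + U) + S * (r' + U * repunit s)
    regroup-carry s r r' = identity r r' U (repunit s) S
      where
      identity : ∀ r r' U f S → (r + S * r') + U * (1 + S * f) ≡ (r + U) + S * (r' + U * f)
      identity = solve-∀

    low-fixed-suc : ∀ s ρ → low (suc s) ρ ≡ ρ → ρ % S < B × low s (ρ / S) ≡ ρ / S
    low-fixed-suc s ρ fixed = subst (_< B) (proj₁ split) (m%n<n _ B) , proj₂ split
      where
      split = divMod-unique S (<-≤-trans (m%n<n _ B) B≤S) (m%n<n ρ S) (trans fixed (m≡m%n+n*[m/n] ρ S))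

    high-carry-suc : ∀ s {r} r' → r < B → high (suc s) ((r + S * r') + U * repunit (suc s)) ≡ 0 →
                     r < b × high s (r' + U * repunit s) ≡ 0
    high-carry-suc s {r} r' r<B noCarry = r<b , m*n≡0⇒m≡0 _ S (trans (*-comm _ S) (m+n≡0⇒n≡0 _ noCarry'))
      where
      noCarry' : B * ((r + U) / B) + S * high s (r' + U * repunit s) ≡ 0
      noCarry' = trans (sym (trans (cong (high (suc s)) (regroup-carry s r r')) (blockwise-+ _ s _ (r+U<S r<B))))
                       noCarry
      r+U<B : r + U < B
      r+U<B = m/n≡0⇒m<n (m*n≡0⇒m≡0 _ B (trans (*-comm _ B) (m+n≡0⇒m≡0 _ noCarry')))
      r<b : r < b
      r<b = +-cancelʳ-< U r b (subst (r + U <_) B≡b+U r+U<B)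

    sum-suc : ∀ s ya yc {r} r' → r < b → b * low (suc s) yc + (r + S * r') ≡ low (suc s) ya →
              yc % S % B ≡ ya % S % B / b × b * low s (yc / S) + r' ≡ low s (ya / S)
    sum-suc s ya yc {r} r' r<b sum = quotient , proj₂ split
      where
      split = divMod-unique S (b*x+r<S (m%n<n _ B) r<b) (<-≤-trans (m%n<n _ B) B≤S)
                (trans (sym (regroup-sum (yc % S % B) (low s (yc / S)) r r')) sum)
      quotient : yc % S % B ≡ ya % S % B / b
      quotient = sym (trans (cong (_/ b) (sym (trans (+-comm r _) (proj₁ split)))) ([r+n*q]/n≡q _ b r<b))

    Quotients : ℕ → ℕ → ℕ → Set
    Quotients s ya yc = ∀ j → j < s → lowHalf yc j ≡ lowHalf ya j / b

    blockDivision-sound : ∀ s ya yc ρ → BlockDivision s ya yc ρ → Quotients s ya yc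
    blockDivision-sound zero    ya yc ρ _ j ()
    blockDivision-sound (suc s) ya yc ρ (fixed , sum , carry) = blockEquations
      where
      ρ≡ : ρ ≡ ρ % S + S * (ρ / S)
      ρ≡ = m≡m%n+n*[m/n] ρ S
      lowFixed = low-fixed-suc s ρ fixed
      carry' = high-carry-suc s (ρ / S) (proj₁ lowFixed)
                 (subst (λ z → high (suc s) (z + U * repunit (suc s)) ≡ 0) ρ≡ carry)
      sum' = sum-suc s ya yc (ρ / S) (proj₁ carry') (subst (λ z → b * low (suc s) yc + z ≡ low (suc s) ya) ρ≡ sum)
      blockEquations : Quotients (suc s) ya yc
      blockEquations zero    _         = trans (lowHalf-zero yc) (trans (proj₁ sum') (cong (_/ b) (sym (lowHalf-zero ya))))
      blockEquations (suc j) (s≤s j<s) = trans (lowHalf-suc yc j) (trans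
        (blockDivision-sound s (ya / S) (yc / S) (ρ / S) (proj₂ lowFixed , proj₂ sum' , proj₂ carry') j j<s)
        (cong (_/ b) (sym (lowHalf-suc ya j))))

    blockDivision-complete : ∀ s ya yc → Quotients s ya yc → BlockDivision s ya yc (remainders s ya)
    blockDivision-complete zero    ya yc _     = refl , trans (+-identityʳ (b * 0)) (*-zeroʳ b) , refl
    blockDivision-complete (suc s) ya yc quot = fixed , sum , carry
      where
      r = ya % S % B % b
      r' = remainders s (ya / S)
      IH = blockDivision-complete s (ya / S) (yc / S) λ j j<s →
             trans (sym (lowHalf-suc yc j)) (trans (quot (suc j) (s≤s j<s)) (cong (_/ b) (lowHalf-suc ya j)))
      r<B : r < B
      r<B = <-trans (m%n<n _ b) b<B
      fixed : low (suc s) (r + S * r') ≡ r + S * r'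
      fixed = trans (blockwise-+ _ s r' (<-≤-trans r<B B≤S))
                    (cong₂ (λ u v → u + S * v) (m<n⇒m%n≡m r<B) (proj₁ IH))
      quotient : yc % S % B ≡ ya % S % B / b
      quotient = trans (sym (lowHalf-zero yc)) (trans (quot 0 (s≤s z≤n)) (cong (_/ b) (lowHalf-zero ya)))
      sum : b * low (suc s) yc + (r + S * r') ≡ low (suc s) ya
      sum = begin
        b * low (suc s) yc + (r + S * r')
          ≡⟨ regroup-sum _ _ r r' ⟩
        b * (yc % S % B) + r + S * (b * low s (yc / S) + r')
          ≡⟨ cong₂ (λ u v → b * u + r + S * v) quotient (proj₁ (proj₂ IH)) ⟩
        b * (ya % S % B / b) + r + S * low s (ya / S)
          ≡⟨ cong (_+ S * low s (ya / S)) (trans (+-comm _ r) (sym (m≡m%n+n*[m/n] _ b))) ⟩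
        low (suc s) ya ∎
        where open ≡-Reasoning
      carry : high (suc s) ((r + S * r') + U * repunit (suc s)) ≡ 0
      carry = begin
        high (suc s) ((r + S * r') + U * repunit (suc s))
          ≡⟨ cong (high (suc s)) (regroup-carry s r r') ⟩
        high (suc s) ((r + U) + S * (r' + U * repunit s))
          ≡⟨ blockwise-+ _ s _ (r+U<S r<B) ⟩
        B * ((r + U) / B) + S * high s (r' + U * repunit s)
          ≡⟨ cong₂ (λ u v → B * u + S * v) (m<n⇒m/n≡0 r+U<B) (proj₂ (proj₂ IH)) ⟩
        B * 0 + S * 0
          ≡⟨ cong₂ _+_ (*-zeroʳ B) (*-zeroʳ S) ⟩
        0 ∎
        where
        open ≡-Reasoning
        r+U<B : r + U < B
        r+U<B = subst (r + U <_) (sym B≡b+U) (+-monoˡ-< U (m%n<n _ b))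

-- Digits in base 2^(2^t)

split-parity : ∀ s (P : ℕ → Set) → (∀ j → j < s → P (j + j)) → (∀ j → j < s → P (suc (j + j))) →
               ∀ k → k < s + s → P k
split-parity (suc s) P even odd zero          _  = even 0 (s≤s z≤n)
split-parity (suc s) P even odd (suc zero)    _  = odd 0 (s≤s z≤n)
split-parity (suc s) P even odd (suc (suc k)) lt =
  split-parity s (λ k → P (suc (suc k)))
    (λ j j<s → subst P (cong suc (+-suc j j)) (even (suc j) (s≤s j<s)))
    (λ j j<s → subst P (cong (λ z → suc (suc z)) (+-suc j j)) (odd (suc j) (s≤s j<s)))
    k (≤-pred (subst (suc (suc k) ≤_) (+-suc s s) (≤-pred lt)))

m^[n+n]≡[m*m]^n : ∀ m n → m ^ (n + n) ≡ (m * m) ^ n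
m^[n+n]≡[m*m]^n m zero    = refl
m^[n+n]≡[m*m]^n m (suc n) = begin
  m * m ^ (n + suc n)  ≡⟨ cong (λ z → m * m ^ z) (+-suc n n) ⟩
  m * (m * m ^ (n + n)) ≡⟨ *-assoc m m _ ⟨
  m * m * m ^ (n + n)  ≡⟨ cong (m * m *_) (m^[n+n]≡[m*m]^n m n) ⟩
  m * m * (m * m) ^ n  ∎
  where open ≡-Reasoning

module Digits (t : ℕ) where
  open Blocks (2 ^ t) public

  digit≡ : ∀ x k → digit x k t ≡ _/_ x (B ^ k) {{m^n≢0 B k}} % B
  digit≡ x k = trans (modN≡% _ B) (cong (_% B) (divN≡/ x (B ^ k) {{m^n≢0 B k}}))

  digit<B : ∀ x k → digit x k t < B
  digit<B x k = subst (_< B) (sym (digit≡ x k)) (m%n<n _ B)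

  digit-suc : ∀ x k → digit x (suc k) t ≡ digit (x / B) k t
  digit-suc x k = trans (digit≡ x (suc k)) (trans
    (cong (_% B) (sym (m/n/o≡m/[n*o] x B (B ^ k) {{_}} {{m^n≢0 B k}} {{m^n≢0 B (suc k)}})))
    (sym (digit≡ (x / B) k)))

  digit-zeroʳ : ∀ x → digit x 0 t ≡ x % B
  digit-zeroʳ x = trans (digit≡ x 0) (cong (_% B) (n/1≡n x))

  digit-small : ∀ {x} → x < B → digit x 0 t ≡ x
  digit-small {x} x<B = trans (digit-zeroʳ x) (m<n⇒m%n≡m x<B)

  digit-zeroˡ : ∀ k → digit 0 k t ≡ 0
  digit-zeroˡ k = trans (digit≡ 0 k)
    (trans (cong (_% B) (0/n≡0 (B ^ k) {{m^n≢0 B k}})) (m<n⇒m%n≡m (m^n>0 2 (2 ^ t))))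

  digits-zero : ∀ m x → x < B ^ m → (∀ k → k < m → digit x k t ≡ 0) → x ≡ 0
  digits-zero zero    x x<1 _     = n<1⇒n≡0 x<1
  digits-zero (suc m) x x<  zeros = begin
    x                      ≡⟨ m≡m%n+n*[m/n] x B ⟩
    x % B + B * (x / B)    ≡⟨ cong₂ (λ u v → u + B * v) lowZero highZero ⟩
    0 + B * 0              ≡⟨ *-zeroʳ B ⟩
    0                      ∎
    where
    open ≡-Reasoning
    lowZero : x % B ≡ 0
    lowZero = trans (sym (digit-zeroʳ x)) (zeros 0 (s≤s z≤n))
    highZero : x / B ≡ 0
    highZero = digits-zero m (x / B) (m<n*o⇒m/o<n (subst (x <_) (*-comm B (B ^ m)) x<))
                 (λ k k<m → trans (sym (digit-suc x k)) (zeros (suc k) (s≤s k<m)))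

  digit-even : ∀ x j → digit x (j + j) t ≡ lowHalf x j
  digit-even x j = trans (digit≡ x (j + j))
    (cong (_% B) (/-congʳ {{m^n≢0 B (j + j)}} {{m^n≢0 S j}} (m^[n+n]≡[m*m]^n B j)))

  digit-odd : ∀ x j → digit x (suc (j + j)) t ≡ lowHalf (x / B) j
  digit-odd x j = trans (digit-suc x (j + j)) (digit-even (x / B) j)

module M (d : ℕ) where

  instance
    size-nonZero : NonZero (size d)
    size-nonZero = 2^n≢0 (nOf d)

  addM-exact : ∀ x y → x + y < size d → addM d x y ≡ x + y
  addM-exact x y lt = trans (modN≡% _ (size d)) (m<n⇒m%n≡m lt)

  mulM-exact : ∀ x y → x * y < size d → mulM d x y ≡ x * y
  mulM-exact x y lt = trans (modN≡% _ (size d)) (m<n⇒m%n≡m lt)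

  pM-exact : ∀ {x} → 2 ^ x < size d → pM d x ≡ 2 ^ x
  pM-exact lt = m≤n⇒m⊓n≡m (<⇒≤pred lt)

  -- x may be 2^n itself (S = 2^n when t = d − 1), hence the reduction modulo 2^n.
  addM-minus : ∀ {x y} → 0 < y → y ≤ x → x ≤ size d →
               addM d (modN x (size d)) (mulM d y (size d ∸ 1)) ≡ x ∸ y
  addM-minus {x} {y} 0<y y≤x x≤size = begin
    addM d (modN x (size d)) (mulM d y (size d ∸ 1))
      ≡⟨ modN≡% _ (size d) ⟩
    (modN x (size d) + modN (y * (size d ∸ 1)) (size d)) % size d
      ≡⟨ cong₂ (λ u v → (u + v) % size d) (modN≡% x (size d)) (modN≡% _ (size d)) ⟩
    (x % size d + y * (size d ∸ 1) % size d) % size d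
      ≡⟨ [x%m+y*[m∸1]%m]%m≡x∸y (size d) 0<y y≤x x≤size ⟩
    x ∸ y ∎
    where open ≡-Reasoning

  pM≡2^ : ∀ {t} → t ≤ d → pM d t ≡ 2 ^ t
  pM≡2^ {t} t≤d = pM-exact {t} (≤-<-trans (^-monoʳ-≤ 2 t≤d) (n<2^n (nOf d)))

DigitQuotients : ℕ → ℕ → ℕ → ℕ → ℕ → Set
DigitQuotients d t a b c = ∀ k → k < 2 ^ (d ∸ t) → digit c k t ≡ divN (digit a k t) b

-- The defining formula

infix 4 _≤F_

_≤F_ : ∀ {v} → Term v → Term v → QF v
x ≤F y = maxT x y ≐ y

_−T_ : ∀ {v} → Term v → Term v → Term v
x −T y = x +T (y ×T cm1)

ifF_then_else_ : ∀ {v} → QF v → QF v → QF v → QF v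
ifF c then p else q = (c ∧F p) ∨F (¬F c ∧F q)

va vb vc vt vr₁ vr₂ : Term 6
va  = var (# 0)
vb  = var (# 1)
vc  = var (# 2)
vt  = var (# 3)
vr₁ = var (# 4)
vr₂ = var (# 5)

-- When t < d these denote B = 2^(2^t), Σ_{j<s} S^j where S = B² and s = 2^(d−t−1)
-- (so that S^s = 2^n), and the masks Σ_j (B − 1) S^j and Σ_j B (B − 1) S^j.
expT baseT repunitT lowMaskT highMaskT : Term 6
expT      = pT vt
baseT     = pT expT
repunitT  = cm1 ÷T ((baseT ×T baseT) −T c1)
lowMaskT  = (baseT −T c1) ×T repunitT
highMaskT = baseT ×T lowMaskT

blockDivF : Term 6 → Term 6 → Term 6 → QF 6
blockDivF x y r =
  ((r ∩T lowMaskT) ≐ r) ∧F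
  ((((vb ×T (y ∩T lowMaskT)) +T r) ≐ (x ∩T lowMaskT)) ∧F
   (((r +T ((baseT −T vb) ×T repunitT)) ∩T highMaskT) ≐ c0))

blocksF : QF 6
blocksF = blockDivF va vc vr₁ ∧F blockDivF (va ÷T baseT) (vc ÷T baseT) vr₂

rangeF : QF 6
rangeF = ¬F (cn ≤F vt) ∧F (expT ≤F cn)

nonzeroDivisorF : QF 6
nonzeroDivisorF =
  ifF expT ≐ cn then vc ≐ (va ÷T vb)
  else ifF baseT ≤F vb then vc ≐ c0
  else blocksF

divisionF : QF 6
divisionF = ifF vb ≐ c0 then vc ≐ c0 else nonzeroDivisorF

env : ℕ → ℕ → ℕ → ℕ → Vector ℕ 2 → Vector ℕ 6
env a b c t w = lookup (a ∷ b ∷ c ∷ t ∷ []) ++ w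

φ : ExFormula 4
φ = ∃F 2 (rangeF ∧F divisionF)

module Evaluation (d t : ℕ) (t<d : t < d) where
  open M d
  open Digits t public

  s : ℕ
  s = 2 ^ (d ∸ suc t)

  n≡s*W : nOf d ≡ s * W
  n≡s*W = begin
    2 ^ d                    ≡⟨ cong (2 ^_) (m∸n+n≡m t<d) ⟨
    2 ^ (d ∸ suc t + suc t)  ≡⟨ ^-distribˡ-+-* 2 (d ∸ suc t) (suc t) ⟩
    s * 2 ^ suc t            ≡⟨ cong (λ z → s * (2 ^ t + z)) (+-identityʳ (2 ^ t)) ⟩
    s * W                    ∎
    where open ≡-Reasoning

  size≡S^s : size d ≡ S ^ s
  size≡S^s = begin
    2 ^ nOf d     ≡⟨ cong (2 ^_) (trans n≡s*W (*-comm s W)) ⟩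
    2 ^ (W * s)   ≡⟨ ^-*-assoc 2 W s ⟨
    (2 ^ W) ^ s   ≡⟨ cong (_^ s) 2^W≡S ⟩
    S ^ s         ∎
    where open ≡-Reasoning

  S≤size : S ≤ size d
  S≤size = subst (S ≤_) (sym size≡S^s) (subst (_≤ S ^ s) (*-identityʳ S) (^-monoʳ-≤ S (m^n>0 2 (d ∸ suc t))))

  B<size : B < size d
  B<size = ^-monoʳ-< 2 (s≤s (s≤s z≤n)) (^-monoʳ-< 2 (s≤s (s≤s z≤n)) t<d)

  2≤B : 2 ≤ B
  2≤B = ^-monoʳ-≤ 2 (m^n>0 2 t)

  B≡1+[B∸1] : B ≡ suc (B ∸ 1)
  B≡1+[B∸1] = sym (m+[n∸m]≡n (<-≤-trans (s≤s z≤n) 2≤B))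

  <size : ∀ {X} K → K ≤ B * (B ∸ 1) → X ≤ K * repunit s → X < size d
  <size {X} K K≤ X≤ = subst (X <_) (sym size≡S^s) (≤*repunit⇒<S^ s (≤-trans K≤ B*[B∸1]≤S∸1) X≤)
    where
    B*[B∸1]≤S∸1 : B * (B ∸ 1) ≤ S ∸ 1
    B*[B∸1]≤S∸1 = begin
      B * (B ∸ 1)    ≡⟨ *-distribˡ-∸ B B 1 ⟩
      S ∸ B * 1      ≡⟨ cong (S ∸_) (*-identityʳ B) ⟩
      S ∸ B          ≤⟨ ∸-monoʳ-≤ S (<-≤-trans (s≤s z≤n) 2≤B) ⟩
      S ∸ 1          ∎
      where open ≤-Reasoning

  b*x+y<size : ∀ {b x y} → b < B → x ≤ (B ∸ 1) * repunit s → y ≤ (B ∸ 1) * repunit s → b * x + y < size d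
  b*x+y<size {b} {x} {y} b<B x≤ y≤ = <size ((B ∸ 1) * (B ∸ 1) + (B ∸ 1)) K≤ (begin
    b * x + y                                              ≤⟨ +-monoˡ-≤ y (*-mono-≤ (<⇒≤pred b<B) x≤) ⟩
    (B ∸ 1) * ((B ∸ 1) * repunit s) + y                    ≤⟨ +-monoʳ-≤ _ y≤ ⟩
    (B ∸ 1) * ((B ∸ 1) * repunit s) + (B ∸ 1) * repunit s  ≡⟨ regroup (B ∸ 1) (repunit s) ⟩
    ((B ∸ 1) * (B ∸ 1) + (B ∸ 1)) * repunit s              ∎)
    where
    open ≤-Reasoning
    regroup : ∀ k f → k * (k * f) + k * f ≡ (k * k + k) * f
    regroup = solve-∀
    K≤ : (B ∸ 1) * (B ∸ 1) + (B ∸ 1) ≤ B * (B ∸ 1)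
    K≤ = ≤-reflexive (trans (+-comm _ (B ∸ 1)) (cong (_* (B ∸ 1)) (sym B≡1+[B∸1])))

  x+u*repunit<size : ∀ {x u} → x ≤ (B ∸ 1) * repunit s → u ≤ B ∸ 1 → x + u * repunit s < size d
  x+u*repunit<size {x} {u} x≤ u≤ = <size ((B ∸ 1) + (B ∸ 1)) K≤ (begin
    x + u * repunit s                          ≤⟨ +-mono-≤ x≤ (*-monoˡ-≤ (repunit s) u≤) ⟩
    (B ∸ 1) * repunit s + (B ∸ 1) * repunit s  ≡⟨ *-distribʳ-+ (repunit s) (B ∸ 1) (B ∸ 1) ⟨
    ((B ∸ 1) + (B ∸ 1)) * repunit s            ∎)
    where
    open ≤-Reasoning
    K≤ : (B ∸ 1) + (B ∸ 1) ≤ B * (B ∸ 1)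
    K≤ = subst (_≤ B * (B ∸ 1)) (cong ((B ∸ 1) +_) (+-identityʳ (B ∸ 1))) (*-monoˡ-≤ (B ∸ 1) 2≤B)

  module _ (ρ : Vector ℕ 6) (ρt : ρ (# 3) ≡ t) where

    eval-baseT : evalT d ρ baseT ≡ B
    eval-baseT = begin
      pM d (pM d (ρ (# 3)))  ≡⟨ cong (λ z → pM d (pM d z)) ρt ⟩
      pM d (pM d t)          ≡⟨ cong (pM d) (pM≡2^ (<⇒≤ t<d)) ⟩
      pM d (2 ^ t)           ≡⟨ pM-exact {2 ^ t} B<size ⟩
      B                      ∎
      where open ≡-Reasoning

    B≡modN : B ≡ modN B (size d)
    B≡modN = sym (trans (modN≡% B (size d)) (m<n⇒m%n≡m B<size))

    eval-baseT−1 : evalT d ρ (baseT −T c1) ≡ B ∸ 1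
    eval-baseT−1 = trans (cong (λ z → addM d z (mulM d 1 (size d ∸ 1))) (trans eval-baseT B≡modN))
                         (addM-minus (s≤s z≤n) (<-≤-trans (s≤s z≤n) 2≤B) (<⇒≤ B<size))

    eval-repunitT : evalT d ρ repunitT ≡ repunit s
    eval-repunitT = begin
      divN (size d ∸ 1) (addM d (mulM d B' B') (mulM d 1 (size d ∸ 1)))
        ≡⟨ cong (λ z → divN (size d ∸ 1) (addM d (mulM d z z) (mulM d 1 (size d ∸ 1)))) eval-baseT ⟩
      divN (size d ∸ 1) (addM d (modN S (size d)) (mulM d 1 (size d ∸ 1)))
        ≡⟨ cong (divN (size d ∸ 1)) (addM-minus (s≤s z≤n) (≤-trans (s≤s z≤n) (≤-trans 2≤B B≤S)) S≤size) ⟩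
      divN (size d ∸ 1) (S ∸ 1)
        ≡⟨ divN≡/ (size d ∸ 1) (S ∸ 1) {{S∸1≢0}} ⟩
      _/_ (size d ∸ 1) (S ∸ 1) {{S∸1≢0}}
        ≡⟨ cong (λ z → _/_ z (S ∸ 1) {{S∸1≢0}}) size∸1≡ ⟩
      _/_ (repunit s * (S ∸ 1)) (S ∸ 1) {{S∸1≢0}}
        ≡⟨ m*n/n≡m (repunit s) (S ∸ 1) {{S∸1≢0}} ⟩
      repunit s ∎
      where
      open ≡-Reasoning
      B' = evalT d ρ baseT
      S∸1≢0 : NonZero (S ∸ 1)
      S∸1≢0 = >-nonZero (m<n⇒0<n∸m (<-≤-trans (s≤s (s≤s z≤n)) (*-mono-≤ 2≤B 2≤B)))
      size∸1≡ : size d ∸ 1 ≡ repunit s * (S ∸ 1)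
      size∸1≡ = trans (cong (_∸ 1) (trans size≡S^s (sym (repunit-bound s))))
                      (trans (m+n∸n≡m _ 1) (*-comm (S ∸ 1) (repunit s)))

    eval-lowMaskT : evalT d ρ lowMaskT ≡ lowMask s
    eval-lowMaskT = trans (cong₂ (mulM d) eval-baseT−1 eval-repunitT)
                          (mulM-exact (B ∸ 1) (repunit s) (<size (B ∸ 1) (m≤n*m (B ∸ 1) B) ≤-refl))

    eval-highMaskT : evalT d ρ highMaskT ≡ highMask s
    eval-highMaskT = trans (cong₂ (mulM d) eval-baseT eval-lowMaskT)
                           (mulM-exact B (lowMask s) (<size (B * (B ∸ 1)) ≤-refl
                             (≤-reflexive (sym (*-assoc B (B ∸ 1) (repunit s))))))

    eval-∩lowMaskT : ∀ z → evalT d ρ (z ∩T lowMaskT) ≡ low s (evalT d ρ z)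
    eval-∩lowMaskT z = trans (cong₂ (λ n m → bitAnd n (evalT d ρ z) m) n≡s*W eval-lowMaskT) (bitAnd-lowMask s _)

    eval-∩highMaskT : ∀ z → evalT d ρ (z ∩T highMaskT) ≡ high s (evalT d ρ z)
    eval-∩highMaskT z = trans (cong₂ (λ n m → bitAnd n (evalT d ρ z) m) n≡s*W eval-highMaskT) (bitAnd-highMask s _)

    module _ (b : ℕ) .{{_ : NonZero b}} (b<B : b < B) (ρb : ρ (# 1) ≡ b) where
      open BlockDivision b b<B

      eval-baseT−vb : evalT d ρ (baseT −T vb) ≡ U
      eval-baseT−vb = trans (cong₂ (λ z y → addM d z (mulM d y (size d ∸ 1))) (trans eval-baseT B≡modN) ρb)
                            (addM-minus (>-nonZero⁻¹ b) (<⇒≤ b<B) (<⇒≤ B<size))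

      eval-sum : ∀ y r → evalT d ρ r ≤ (B ∸ 1) * repunit s →
                 evalT d ρ ((vb ×T (y ∩T lowMaskT)) +T r) ≡ b * low s (evalT d ρ y) + evalT d ρ r
      eval-sum y r r≤ = begin
        addM d (mulM d (ρ (# 1)) (evalT d ρ (y ∩T lowMaskT))) Rem
          ≡⟨ cong₂ (λ u v → addM d (mulM d u v) Rem) ρb (eval-∩lowMaskT y) ⟩
        addM d (mulM d b (low s Y)) Rem
          ≡⟨ cong (λ z → addM d z Rem) (mulM-exact b (low s Y) (≤-<-trans (m≤m+n _ Rem) lt)) ⟩
        addM d (b * low s Y) Rem
          ≡⟨ addM-exact _ Rem lt ⟩
        b * low s Y + Rem ∎
        where
        open ≡-Reasoning
        Y = evalT d ρ y
        Rem = evalT d ρ r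
        lt : b * low s Y + Rem < size d
        lt = b*x+y<size b<B (lowBound s Y) r≤

      eval-carry : ∀ r → evalT d ρ r ≤ (B ∸ 1) * repunit s →
                   evalT d ρ ((r +T ((baseT −T vb) ×T repunitT)) ∩T highMaskT) ≡
                   high s (evalT d ρ r + U * repunit s)
      eval-carry r r≤ = trans (eval-∩highMaskT (r +T ((baseT −T vb) ×T repunitT))) (cong (high s) (begin
        addM d Rem (mulM d (evalT d ρ (baseT −T vb)) (evalT d ρ repunitT))
          ≡⟨ cong₂ (λ u v → addM d Rem (mulM d u v)) eval-baseT−vb eval-repunitT ⟩
        addM d Rem (mulM d U (repunit s))
          ≡⟨ cong (addM d Rem) (mulM-exact U (repunit s) (≤-<-trans (m≤n+m _ Rem) lt)) ⟩
        addM d Rem (U * repunit s)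
          ≡⟨ addM-exact Rem _ lt ⟩
        Rem + U * repunit s ∎))
        where
        open ≡-Reasoning
        Rem = evalT d ρ r
        lt : Rem + U * repunit s < size d
        lt = x+u*repunit<size r≤ (∸-monoʳ-≤ B (>-nonZero⁻¹ b))

      blockDivF⇔ : ∀ x y r → SatQF d ρ (blockDivF x y r) ⇔
                             BlockDivision s (evalT d ρ x) (evalT d ρ y) (evalT d ρ r)
      blockDivF⇔ x y r = mk⇔ to from
        where
        to : SatQF d ρ (blockDivF x y r) → BlockDivision s _ _ _
        to (fixed , sum , carry) = lowR , trans (sym (eval-sum y r r≤)) (trans sum (eval-∩lowMaskT x)) ,
                                   trans (sym (eval-carry r r≤)) carry
          where
          lowR = trans (sym (eval-∩lowMaskT r)) fixed
          r≤ = low-fixed⇒≤ s _ lowR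
        from : BlockDivision s _ _ _ → SatQF d ρ (blockDivF x y r)
        from (lowR , sum , carry) = trans (eval-∩lowMaskT r) lowR ,
                                    trans (eval-sum y r r≤) (trans sum (sym (eval-∩lowMaskT x))) ,
                                    trans (eval-carry r r≤) carry
          where r≤ = low-fixed⇒≤ s _ lowR

  2^[d∸t]≡s+s : 2 ^ (d ∸ t) ≡ s + s
  2^[d∸t]≡s+s = trans (cong (2 ^_) (+-∸-assoc 1 t<d)) (cong (s +_) (+-identityʳ s))

  eval-÷baseT : ∀ {a b c} w z → evalT d (env a b c t w) (z ÷T baseT) ≡ evalT d (env a b c t w) z / B
  eval-÷baseT {a} {b} {c} w z = trans (cong (divN _) (eval-baseT (env a b c t w) refl)) (divN≡/ _ B)

  module _ {b : ℕ} .{{_ : NonZero b}} (b<B : b < B) where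
    open BlockDivision b b<B

    quotients-blocks : ∀ {a c} → DigitQuotients d t a b c ⇔ (Quotients s a c × Quotients s (a / B) (c / B))
    quotients-blocks {a} {c} = mk⇔ to from
      where
      P : ℕ → Set
      P k = digit c k t ≡ divN (digit a k t) b
      even : ∀ j → P (j + j) ≡ (lowHalf c j ≡ lowHalf a j / b)
      even j = cong₂ _≡_ (digit-even c j) (trans (divN≡/ _ b) (cong (_/ b) (digit-even a j)))
      odd : ∀ j → P (suc (j + j)) ≡ (lowHalf (c / B) j ≡ lowHalf (a / B) j / b)
      odd j = cong₂ _≡_ (digit-odd c j) (trans (divN≡/ _ b) (cong (_/ b) (digit-odd a j)))
      to : DigitQuotients d t a b c → Quotients s a c × Quotients s (a / B) (c / B)
      to q = (λ j j<s → subst id (even j) (q (j + j) (bound (+-mono-< j<s j<s)))) ,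
             (λ j j<s → subst id (odd j) (q (suc (j + j))
                          (bound (subst (_≤ s + s) (cong suc (+-suc j j)) (+-mono-≤ j<s j<s)))))
        where
        bound : ∀ {k} → k < s + s → k < 2 ^ (d ∸ t)
        bound = subst (_ <_) (sym 2^[d∸t]≡s+s)
      from : Quotients s a c × Quotients s (a / B) (c / B) → DigitQuotients d t a b c
      from (qEven , qOdd) k k< = split-parity s P (λ j j<s → subst id (sym (even j)) (qEven j j<s))
                                                  (λ j j<s → subst id (sym (odd j)) (qOdd j j<s))
                                                  k (subst (k <_) 2^[d∸t]≡s+s k<)

    blocksF⇔ : ∀ {a c} w → SatQF d (env a b c t w) blocksF ⇔
               (BlockDivision s a c (w (# 0)) × BlockDivision s (a / B) (c / B) (w (# 1)))
    blocksF⇔ {a} {c} w = mk⇔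
      (λ (sat₁ , sat₂) → to (divF va vc vr₁) sat₁ ,
                         subst id halved (to (divF (va ÷T baseT) (vc ÷T baseT) vr₂) sat₂))
      (λ (div₁ , div₂) → from (divF va vc vr₁) div₁ ,
                         from (divF (va ÷T baseT) (vc ÷T baseT) vr₂) (subst id (sym halved) div₂))
      where
      open Equivalence
      ρ = env a b c t w
      divF = blockDivF⇔ ρ refl b b<B refl
      halved : BlockDivision s (evalT d ρ (va ÷T baseT)) (evalT d ρ (vc ÷T baseT)) (w (# 1)) ≡
               BlockDivision s (a / B) (c / B) (w (# 1))
      halved = cong₂ (λ x y → BlockDivision s x y (w (# 1)))
                     (eval-÷baseT {a} {b} {c} w va) (eval-÷baseT {a} {b} {c} w vc)

    blocksF-sound : ∀ {a c} w → SatQF d (env a b c t w) blocksF → DigitQuotients d t a b c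
    blocksF-sound {a} {c} w sat = Equivalence.from quotients-blocks
      (blockDivision-sound s a c _ div₁ , blockDivision-sound s (a / B) (c / B) _ div₂)
      where
      div₁ = proj₁ (Equivalence.to (blocksF⇔ w) sat)
      div₂ = proj₂ (Equivalence.to (blocksF⇔ w) sat)

    blocksF-complete : ∀ {a c} → DigitQuotients d t a b c →
                       Σ (Vector ℕ 2) λ w → (∀ i → w i < size d) × SatQF d (env a b c t w) blocksF
    blocksF-complete {a} {c} q = w , w<size , Equivalence.from (blocksF⇔ w)
      (blockDivision-complete s a c (proj₁ quots) , blockDivision-complete s (a / B) (c / B) (proj₂ quots))
      where
      quots = Equivalence.to quotients-blocks q
      w : Vector ℕ 2
      w = lookup (remainders s a ∷ remainders s (a / B) ∷ [])
      remainders<size : ∀ y → remainders s y < size d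
      remainders<size y = <size (B ∸ 1) (m≤n*m (B ∸ 1) B)
        (blockwise-≤ (λ v _ → <⇒≤pred (<-trans (m%n<n _ b) b<B)) s y)
      w<size : ∀ i → w i < size d
      w<size zero       = remainders<size a
      w<size (suc zero) = remainders<size (a / B)

-- Correctness of the formula

divN-small : ∀ {x y} → x < y → divN x y ≡ 0
divN-small {y = suc y} x<y = m<n⇒m/n≡0 x<y

size≡[2^2^t]^2^[d∸t] : ∀ d t → t ≤ d → size d ≡ (2 ^ 2 ^ t) ^ 2 ^ (d ∸ t)
size≡[2^2^t]^2^[d∸t] d t t≤d = begin
  2 ^ 2 ^ d                    ≡⟨ cong (λ z → 2 ^ 2 ^ z) (m+[n∸m]≡n t≤d) ⟨
  2 ^ 2 ^ (t + (d ∸ t))        ≡⟨ cong (2 ^_) (^-distribˡ-+-* 2 t (d ∸ t)) ⟩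
  2 ^ (2 ^ t * 2 ^ (d ∸ t))    ≡⟨ ^-*-assoc 2 (2 ^ t) (2 ^ (d ∸ t)) ⟨
  (2 ^ 2 ^ t) ^ 2 ^ (d ∸ t)    ∎
  where open ≡-Reasoning

quotients-top : ∀ d {a b c} → a < size d → c < size d → DigitQuotients d d a b c ⇔ c ≡ divN a b
quotients-top d {a} {b} {c} a< c< = mk⇔ to from
  where
  open Digits d
  to : DigitQuotients d d a b c → c ≡ divN a b
  to q = trans (sym (digit-small c<)) (trans (q 0 (m^n>0 2 (d ∸ d))) (cong (λ z → divN z b) (digit-small a<)))
  from : c ≡ divN a b → DigitQuotients d d a b c
  from c≡ k k< with n<1⇒n≡0 (subst (λ z → k < 2 ^ z) (n∸n≡0 d) k<)
  ... | refl = trans (digit-small c<) (trans c≡ (cong (λ z → divN z b) (sym (digit-small a<))))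

quotients-large : ∀ d t {a b c} → t ≤ d → c < size d → 2 ^ 2 ^ t ≤ b → DigitQuotients d t a b c ⇔ c ≡ 0
quotients-large d t {a} {b} {c} t≤d c< B≤b = mk⇔ to from
  where
  open Digits t
  quotient≡0 : ∀ k → divN (digit a k t) b ≡ 0
  quotient≡0 k = divN-small (<-≤-trans (digit<B a k) B≤b)
  to : DigitQuotients d t a b c → c ≡ 0
  to q = digits-zero (2 ^ (d ∸ t)) c (subst (c <_) (size≡[2^2^t]^2^[d∸t] d t t≤d) c<)
                     (λ k k< → trans (q k k<) (quotient≡0 k))
  from : c ≡ 0 → DigitQuotients d t a b c
  from refl k _ = trans (digit-zeroˡ k) (sym (quotient≡0 k))

rangeF⇔ : ∀ d ρ → SatQF d ρ rangeF ⇔ ρ (# 3) ≤ d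
rangeF⇔ d ρ = mk⇔ to from
  where
  open M d
  t = ρ (# 3)
  to : SatQF d ρ rangeF → t ≤ d
  to (n≰t , p≤n) = 2^-cancel-≤ (subst (_≤ nOf d) (pM-exact {t} 2^t<size) (m⊔n≡n⇒m≤n p≤n))
    where
    2^t<size : 2 ^ t < size d
    2^t<size = ^-monoʳ-< 2 (s≤s (s≤s z≤n)) (≰⇒> λ n≤t → n≰t (m≤n⇒m⊔n≡n n≤t))
  from : t ≤ d → SatQF d ρ rangeF
  from t≤d = (λ n⊔t≡t → <⇒≱ (≤-<-trans t≤d (n<2^n d)) (m⊔n≡n⇒m≤n n⊔t≡t)) ,
             m≤n⇒m⊔n≡n (subst (_≤ nOf d) (sym (pM≡2^ t≤d)) (^-monoʳ-≤ 2 t≤d))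

module Correctness (d a b c t : ℕ) (a< : a < size d) (c< : c < size d) (t≤d : t ≤ d) where
  open M d
  open Equivalence using (to; from)

  ρ : Vector ℕ 2 → Vector ℕ 6
  ρ = env a b c t

  Witnessed : QF 6 → Set
  Witnessed ψ = Σ (Vector ℕ 2) λ w → (∀ i → w i < size d) × SatQF d (ρ w) ψ

  witnessedByZeros : ∀ {ψ} → (∀ w → SatQF d (ρ w) ψ) → Witnessed ψ
  witnessedByZeros sat = (λ _ → 0) , (λ _ → m^n>0 2 (nOf d)) , sat (λ _ → 0)

  top⇔ : pM d t ≡ nOf d ⇔ t ≡ d
  top⇔ = mk⇔ (λ top → 2^-injective (trans (sym (pM≡2^ t≤d)) top))
             (λ t≡d → trans (pM≡2^ t≤d) (cong (2 ^_) t≡d))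

  large⇔ : ∀ w → t < d → evalT d (ρ w) baseT ⊔ b ≡ b ⇔ 2 ^ 2 ^ t ≤ b
  large⇔ w t<d = mk⇔ (λ large → subst (_≤ b) eval-baseT (m⊔n≡n⇒m≤n large))
                     (λ B≤b → trans (cong (_⊔ b) eval-baseT) (m≤n⇒m⊔n≡n B≤b))
    where
    eval-baseT : evalT d (ρ w) baseT ≡ 2 ^ 2 ^ t
    eval-baseT = Evaluation.eval-baseT d t t<d (ρ w) refl

  divisionF-sound : ∀ w → SatQF d (ρ w) divisionF → OslashIs d t a b c
  divisionF-sound w (inj₁ zero-case)        = inj₁ zero-case
  divisionF-sound w (inj₂ (b≢0 , nonZero)) = inj₂ (b≢0 , quotients nonZero)
    where
    instance
      b-nonZero : NonZero b
      b-nonZero = ≢-nonZero b≢0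
    quotients : SatQF d (ρ w) nonzeroDivisorF → DigitQuotients d t a b c
    quotients (inj₁ (top , c≡a÷b)) =
      subst (λ t → DigitQuotients d t a b c) (sym (to top⇔ top))
            (from (quotients-top d {a} {b} {c} a< c<) c≡a÷b)
    quotients (inj₂ (notTop , inj₁ (large , c≡0))) =
      from (quotients-large d t t≤d c< (to (large⇔ w t<d) large)) c≡0
      where t<d = ≤∧≢⇒< t≤d (notTop ∘ from top⇔)
    quotients (inj₂ (notTop , inj₂ (notLarge , blocks))) =
      Evaluation.blocksF-sound d t t<d (≰⇒> (notLarge ∘ from (large⇔ w t<d))) {a} {c} w blocks
      where t<d = ≤∧≢⇒< t≤d (notTop ∘ from top⇔)

  divisionF-complete : OslashIs d t a b c → Witnessed divisionF
  divisionF-complete (inj₁ zero-case) = witnessedByZeros {divisionF} λ _ → inj₁ zero-case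
  divisionF-complete (inj₂ (b≢0 , q)) with t ≟ d
  ... | yes t≡d = witnessedByZeros {divisionF} λ _ → inj₂ (b≢0 , inj₁ (from top⇔ t≡d ,
                    to (quotients-top d {a} {b} {c} a< c<) (subst (λ t → DigitQuotients d t a b c) t≡d q)))
  ... | no t≢d with 2 ^ 2 ^ t ≤? b
  ...   | yes B≤b = witnessedByZeros {divisionF} λ w → inj₂ (b≢0 , inj₂ (t≢d ∘ to top⇔ , inj₁
                      (from (large⇔ w (≤∧≢⇒< t≤d t≢d)) B≤b ,
                       to (quotients-large d t t≤d c< B≤b) q)))
  ...   | no B≰b
    with Evaluation.blocksF-complete d t (≤∧≢⇒< t≤d t≢d) {{≢-nonZero b≢0}} (≰⇒> B≰b) {a} {c} q
  ...     | w , w<size , blocks =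
    w , w<size , inj₂ (b≢0 , inj₂ (t≢d ∘ to top⇔ , inj₂ (B≰b ∘ to (large⇔ w (≤∧≢⇒< t≤d t≢d)) , blocks)))

lemma37 : Σ (ExFormula 4) λ φ →
    (d a b c t : ℕ) → a < size d → b < size d → c < size d → t < size d →
    (R d a b c t ⇔ Sat d (lookup (a ∷ b ∷ c ∷ t ∷ [])) φ)
lemma37 = φ , λ d a b c t a< _ c< _ → mk⇔
  (λ (t≤d , oslash) → let open Correctness d a b c t a< c< t≤d
                          (w , w<size , sat) = divisionF-complete oslash
                      in w , w<size , Equivalence.from (rangeF⇔ d (ρ w)) t≤d , sat)
  (λ (w , _ , range , sat) → let t≤d = Equivalence.to (rangeF⇔ d (env a b c t w)) range
                             in t≤d , Correctness.divisionF-sound d a b c t a< c< t≤d w sat)
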